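{- If $\Gamma=\mathrm{AG}(2,q)$ with $q\ge 3$ or $\Gamma=\mathrm{PG}(2,q)$ with $q\ge 2$, then the triangle complex $\Delta(\Gamma)$ is residually connected.
   Context: $\mathrm{AG}(2,q)$ and $\mathrm{PG}(2,q)$ denote the affine and projective planes over $\mathrm{GF}(q)$ viewed as rank two geometries of points and lines. Triangle complex: $\Delta(\Gamma)$ is the rank three incidence system over $\{1,2,3\}$ whose elements are the triples $(p,L,i)$ with $p$ incident with $L$ and $i\in\{1,2,3\}$; the type of $(p,L,i)$ is $i$; and $(p,L,i)$ is incident with $(p',L',i \bmod 3+1)$ if and only if the set of points incident with both $L$ and $L'$ is exactly $\{p\}$ and $p\neq p'$ (incidence symmetric and reflexive, no other incidences). The residue of a flag $F$ (set of pairwise incident elements) is the set of elements incident with every element of $F$ but not in $F$, of rank $3-|F|$; a geometry is residually connected if the incidence graph (edges between incident elements of different types) of every residue of rank at least $2$, including the whole geometry, is connected. -}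

module Defs where

open import Level using (0ℓ)
open import Data.Nat using (ℕ; _≤_; _∸_)
open import Data.Fin using (Fin; zero; suc)
open import Data.Product using (Σ; _×_; _,_; ∃)
open import Data.Sum using (_⊎_; inj₁; inj₂)
open import Data.Unit using (⊤; tt)
open import Data.List using (List; length)
open import Data.List.Relation.Unary.All using (All)
open import Data.List.Relation.Unary.Any using (Any)
open import Data.List.Relation.Unary.AllPairs using (AllPairs)
open import Relation.Nullary using (¬_)
open import Relation.Binary.PropositionalEquality using (_≡_; _≢_)
open import Algebra.Structures using (IsCommutativeRing)

-- Every finite field with q elements (i.e. GF(q)) is isomorphic to one
-- of these, so quantifying over all of them is quantifying over GF(q).

record FiniteField (q : ℕ) : Set where
  field
    _+_ _*_ : Fin q → Fin q → Fin q
    -_      : Fin q → Fin q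
    0# 1#   : Fin q
    isCommutativeRing : IsCommutativeRing _≡_ _+_ _*_ -_ 0# 1#
    0≢1     : 0# ≢ 1#
    inverse : ∀ x → x ≢ 0# → ∃ λ y → x * y ≡ 1#
  infixl 6 _+_
  infixl 7 _*_

-- Rank two geometries (points, lines, incidence); equality of points
-- and of lines is propositional equality (canonical representatives).

record Geometry : Set₁ where
  field
    Point : Set
    Line  : Set
    _I_   : Point → Line → Set

-- AG(2,F): points (x,y); lines y = m x + c  (inj₁ (m , c))  or
-- x = c  (inj₂ c).  Each line has exactly one such representative.

AG : ∀ {q} → FiniteField q → Geometry
AG {q} F = record
  { Point = Fin q × Fin q
  ; Line  = (Fin q × Fin q) ⊎ Fin q
  ; _I_   = inc
  }
  where
  open FiniteField F
  inc : Fin q × Fin q → (Fin q × Fin q) ⊎ Fin q → Set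
  inc (x , y) (inj₁ (m , c)) = y ≡ m * x + c
  inc (x , y) (inj₂ c)       = x ≡ c

-- PG(2,F): one-dimensional subspaces of F³, given by their normalised
-- representatives (1,a,b), (0,1,a), (0,0,1); lines likewise (by the
-- normalised coefficient vector [l₀,l₁,l₂] of l₀X₀+l₁X₁+l₂X₂ = 0).

Proj : ℕ → Set
Proj q = (Fin q × Fin q) ⊎ (Fin q ⊎ ⊤)

PG : ∀ {q} → FiniteField q → Geometry
PG {q} F = record
  { Point = Proj q
  ; Line  = Proj q
  ; _I_   = λ p L → dot (coords p) (coords L) ≡ 0#
  }
  where
  open FiniteField F
  coords : Proj q → Fin q × Fin q × Fin q
  coords (inj₁ (a , b))   = 1# , a , b
  coords (inj₂ (inj₁ a))  = 0# , 1# , a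
  coords (inj₂ (inj₂ tt)) = 0# , 0# , 1#
  dot : Fin q × Fin q × Fin q → Fin q × Fin q × Fin q → Fin q
  dot (x₀ , x₁ , x₂) (l₀ , l₁ , l₂) = x₀ * l₀ + x₁ * l₁ + x₂ * l₂

record IncidenceSystem : Set₁ where
  field
    Elem  : Set
    _≈_   : Elem → Elem → Set
    type  : Elem → Fin 3
    _*_   : Elem → Elem → Set

module _ (Δ : IncidenceSystem) where
  open IncidenceSystem Δ

  IsFlag : List Elem → Set
  IsFlag F = AllPairs (λ a b → ¬ (a ≈ b)) F × AllPairs _*_ F

  InResidue : List Elem → Elem → Set
  InResidue F e = All (λ f → e * f) F × ¬ Any (λ f → e ≈ f) F

  data Walk (R : Elem → Set) : Elem → Elem → Set where
    stop : ∀ {x y} → x ≈ y → Walk R x y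
    step : ∀ {x y z} → R y → x * y → type x ≢ type y →
           Walk R y z → Walk R x z

  ConnectedOn : (Elem → Set) → Set
  ConnectedOn R = ∀ x y → R x → R y → Walk R x y

  -- residually connected: the incidence graph of every residue of rank
  -- at least two (rank of the residue of F is 3 - |F|), including the
  -- residue of the empty flag (the whole geometry), is connected
  ResiduallyConnected : Set
  ResiduallyConnected =
    ∀ (F : List Elem) → IsFlag F → 2 ≤ 3 ∸ length F →
    ConnectedOn (InResidue F)

next : Fin 3 → Fin 3
next zero             = suc zero
next (suc zero)       = suc (suc zero)
next (suc (suc zero)) = zero

record TriElem (Γ : Geometry) : Set where
  constructor tri
  open Geometry Γ
  field
    pt   : Point
    ln   : Line
    inc  : pt I ln
    ty   : Fin 3

module _ (Γ : Geometry) where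
  open Geometry Γ
  open TriElem

  _≈T_ : TriElem Γ → TriElem Γ → Set
  a ≈T b = pt a ≡ pt b × ln a ≡ ln b × ty a ≡ ty b

  MeetExactly : Line → Line → Point → Set
  MeetExactly L L' p =
    p I L × p I L' × (∀ x → x I L → x I L' → x ≡ p)

  -- directed condition for (p,L,i) to be incident with (p',L',i mod 3 + 1)
  TriStep : TriElem Γ → TriElem Γ → Set
  TriStep a b = ty b ≡ next (ty a) × MeetExactly (ln a) (ln b) (pt a)
              × pt a ≢ pt b

  TriInc : TriElem Γ → TriElem Γ → Set
  TriInc a b = a ≈T b ⊎ TriStep a b ⊎ TriStep b a

  TriangleComplex : IncidenceSystem
  TriangleComplex = record
    { Elem = TriElem Γ
    ; _≈_  = _≈T_
    ; type = ty
    ; _*_  = TriInc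
    }

-- Both planes are thick linear spaces (two points lie on a unique line, every line has three
-- points and every point three lines) in which, through any point b, some line other than a
-- given L meets two given lines ℓ and ℓ′.  In PG(2,q) any two lines meet; in AG(2,q) the line
-- through b needs a direction different from those of L, ℓ and ℓ′, which exists iff q ≥ 3.
--
-- In such a plane Δ is connected: two elements of the same type through a common point (on a
-- common line) have a common neighbour of the next (previous) type, points are joined by lines,
-- and every element has a neighbour of the next type.  The residue of f = (p, L, i) consists of
-- the successors (w, pw, i+1) with w off L and the predecessors (v, N, i-1) with v ∈ L∖{p} and
-- p ∉ N, and a successor is adjacent to a predecessor exactly when w ∈ N.  Every predecessor is
-- adjacent to a successor, and the successors at x and y are linked via the lines xα and yα for
-- a point α ∈ L∖{p} and a line through a third point β of L meeting both.  Flags with two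
-- elements have residues of rank one.

module Submission where

open import Defs
open import Level using (0ℓ)
open import Data.Nat as ℕ using (ℕ; zero; suc; _≤_; _<_; s≤s)
open import Data.Nat.Properties using (≤-trans; m∸n≤m; m≤n⇒m≤1+n; +-suc)
open import Data.Integer as ℤ using (ℤ; -[1+_]; _⊖_; _◃_; sign; ∣_∣)
import Data.Integer.Properties as ℤ
open import Data.Sign as Sign using (Sign)
open import Data.Fin using (Fin; zero; suc; #_)
open import Data.Fin.Properties using (any?; pigeonhole; <⇒≢) renaming (_≟_ to _≟ᶠ_)
open import Data.List using (List; []; _∷_; length; lookup)
open import Data.List.Relation.Unary.All using (_∷_; [])
open import Data.List.Relation.Unary.Any using (here; there; index)
open import Data.List.Relation.Unary.Any.Properties using (lookup-index)
open import Data.List.Membership.Propositional using (_∈_; _∉_)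
import Data.List.Membership.DecPropositional as DecMembership
open import Data.Maybe using (Maybe; map)
open import Data.Product using (∃; _×_; _,_; proj₁; proj₂)
import Data.Product.Properties as Product
open import Data.Sum using (_⊎_; inj₁; inj₂)
import Data.Sum.Properties as Sum
open import Data.Unit using (⊤; tt)
import Data.Unit.Properties as Unit
open import Data.Empty using (⊥-elim)
open import Function using (_∘_; id)
open import Function.Definitions using (Injective)
open import Relation.Nullary using (¬_; yes; no; ¬?; contradiction)
open import Relation.Nullary.Decidable using (decidable-stable)
open import Relation.Binary using (IsEquivalence; DecidableEquality)
open import Relation.Binary.Consequences using (dec⇒weaklyDec)
open import Relation.Binary.PropositionalEquality
  using (_≡_; _≢_; refl; sym; trans; cong; cong₂; subst; module ≡-Reasoning)
open import Algebra.Bundles using (CommutativeRing)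
open import Algebra.Solver.Ring.AlmostCommutativeRing
  using (fromCommutativeRing; _-Raw-AlmostCommutative⟶_)
import Algebra.Solver.Ring

module FromInteger {c ℓ} (R : CommutativeRing c ℓ) where
  open CommutativeRing R renaming (refl to ≈-refl; sym to ≈-sym; trans to ≈-trans)
  open import Algebra.Properties.Ring ring using (-‿distribˡ-*; -‿distribʳ-*)
  open import Algebra.Properties.AbelianGroup +-abelianGroup
    using (ε⁻¹≈ε; ⁻¹-involutive; ⁻¹-∙-comm)
  open import Algebra.Properties.Semiring.Mult.TCOptimised semiring
    using (1+×; ×-homo-+; ×1-homo-*) renaming (_×_ to _·_)
  open import Relation.Binary.Reasoning.Setoid setoid

  fromℤ : ℤ → Carrier
  fromℤ (ℤ.+ n)      = n · 1#
  fromℤ -[1+ n ]   = - (suc n · 1#)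

  signed : Sign → Carrier → Carrier
  signed Sign.+ x = x
  signed Sign.- x = - x

  signed-cong : ∀ s {x y} → x ≈ y → signed s x ≈ signed s y
  signed-cong Sign.+ x≈y = x≈y
  signed-cong Sign.- x≈y = -‿cong x≈y

  signed-* : ∀ s t x y → signed (s Sign.* t) (x * y) ≈ signed s x * signed t y
  signed-* Sign.+ Sign.+ x y = ≈-refl
  signed-* Sign.+ Sign.- x y = -‿distribʳ-* x y
  signed-* Sign.- Sign.+ x y = -‿distribˡ-* x y
  signed-* Sign.- Sign.- x y = begin
    x * y         ≈⟨ ⁻¹-involutive (x * y) ⟨
    - - (x * y)   ≈⟨ -‿cong (-‿distribʳ-* x y) ⟩
    - (x * - y)   ≈⟨ -‿distribˡ-* x (- y) ⟩
    - x * - y     ∎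

  fromℤ-◃ : ∀ s n → fromℤ (s ◃ n) ≈ signed s (n · 1#)
  fromℤ-◃ Sign.+ zero    = ≈-refl
  fromℤ-◃ Sign.- zero    = ≈-sym ε⁻¹≈ε
  fromℤ-◃ Sign.+ (suc n) = ≈-refl
  fromℤ-◃ Sign.- (suc n) = ≈-refl

  fromℤ-signAbs : ∀ i → fromℤ i ≈ signed (sign i) (∣ i ∣ · 1#)
  fromℤ-signAbs (ℤ.+ n)    = ≈-refl
  fromℤ-signAbs -[1+ n ] = ≈-refl

  fromℤ-⊖ : ∀ m n → fromℤ (m ⊖ n) ≈ m · 1# - n · 1#
  fromℤ-⊖ m zero = begin
    m · 1#        ≈⟨ +-identityʳ _ ⟨
    m · 1# + 0#   ≈⟨ +-congˡ ε⁻¹≈ε ⟨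
    m · 1# - 0#   ∎
  fromℤ-⊖ zero (suc n) = ≈-sym (+-identityˡ _)
  fromℤ-⊖ (suc m) (suc n) = begin
    fromℤ (suc m ⊖ suc n)                 ≡⟨ cong fromℤ (ℤ.[1+m]⊖[1+n]≡m⊖n m n) ⟩
    fromℤ (m ⊖ n)                         ≈⟨ fromℤ-⊖ m n ⟩
    m · 1# - n · 1#                       ≈⟨ +-congʳ (+-identityˡ _) ⟨
    0# + m · 1# - n · 1#                  ≈⟨ +-congʳ (+-congʳ (-‿inverseʳ 1#)) ⟨
    1# - 1# + m · 1# - n · 1#             ≈⟨ +-congʳ (+-assoc 1# (- 1#) _) ⟩
    1# + (- 1# + m · 1#) - n · 1#         ≈⟨ +-congʳ (+-congˡ (+-comm (- 1#) _)) ⟩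
    1# + (m · 1# - 1#) - n · 1#           ≈⟨ +-congʳ (+-assoc 1# _ (- 1#)) ⟨
    1# + m · 1# - 1# - n · 1#             ≈⟨ +-assoc (1# + m · 1#) (- 1#) _ ⟩
    1# + m · 1# + (- 1# - n · 1#)         ≈⟨ +-congˡ (⁻¹-∙-comm 1# _) ⟩
    1# + m · 1# - (1# + n · 1#)           ≈⟨ +-cong (1+× m 1#) (-‿cong (1+× n 1#)) ⟨
    suc m · 1# - suc n · 1#               ∎

  fromℤ-+ : ∀ i j → fromℤ (i ℤ.+ j) ≈ fromℤ i + fromℤ j
  fromℤ-+ (ℤ.+ m)    (ℤ.+ n)    = ×-homo-+ 1# m n
  fromℤ-+ (ℤ.+ m)    -[1+ n ] = fromℤ-⊖ m (suc n)
  fromℤ-+ -[1+ m ] (ℤ.+ n)    = ≈-trans (fromℤ-⊖ n (suc m)) (+-comm _ _)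
  fromℤ-+ -[1+ m ] -[1+ n ] = begin
    - (suc (suc (m ℕ.+ n)) · 1#)      ≡⟨ cong (λ k → - (suc k · 1#)) (sym (+-suc m n)) ⟩
    - ((suc m ℕ.+ suc n) · 1#)        ≈⟨ -‿cong (×-homo-+ 1# (suc m) (suc n)) ⟩
    - (suc m · 1# + suc n · 1#)       ≈⟨ ⁻¹-∙-comm _ _ ⟨
    - (suc m · 1#) + - (suc n · 1#)   ∎

  fromℤ-* : ∀ i j → fromℤ (i ℤ.* j) ≈ fromℤ i * fromℤ j
  fromℤ-* i j = begin
    fromℤ (s ◃ ∣ i ∣ ℕ.* ∣ j ∣)                                    ≈⟨ fromℤ-◃ s (∣ i ∣ ℕ.* ∣ j ∣) ⟩
    signed s ((∣ i ∣ ℕ.* ∣ j ∣) · 1#)                              ≈⟨ signed-cong s (×1-homo-* ∣ i ∣ ∣ j ∣) ⟩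
    signed s (∣ i ∣ · 1# * ∣ j ∣ · 1#)                             ≈⟨ signed-* (sign i) (sign j) _ _ ⟩
    signed (sign i) (∣ i ∣ · 1#) * signed (sign j) (∣ j ∣ · 1#)   ≈⟨ *-cong (fromℤ-signAbs i) (fromℤ-signAbs j) ⟨
    fromℤ i * fromℤ j                                              ∎
    where
    s : Sign
    s = sign i Sign.* sign j

  fromℤ-- : ∀ i → fromℤ (ℤ.- i) ≈ - fromℤ i
  fromℤ-- (ℤ.+ zero)  = ≈-sym ε⁻¹≈ε
  fromℤ-- (ℤ.+ suc n) = ≈-refl
  fromℤ-- -[1+ n ]  = ≈-sym (⁻¹-involutive _)

  homomorphism : ℤ.+-*-rawRing -Raw-AlmostCommutative⟶ fromCommutativeRing R
  homomorphism = record
    { ⟦_⟧    = fromℤ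
    ; +-homo = fromℤ-+
    ; *-homo = fromℤ-*
    ; -‿homo = fromℤ--
    ; 0-homo = ≈-refl
    ; 1-homo = ≈-refl
    }

  fromℤ-≟ : ∀ i j → Maybe (fromℤ i ≈ fromℤ j)
  fromℤ-≟ i j = map (reflexive ∘ cong fromℤ) (dec⇒weaklyDec ℤ._≟_ i j)

-- Integer coefficients compute, so normalisation can cancel terms such as x - x; coefficients
-- taken from the abstract field itself would not.
module RingSolver {c ℓ} (R : CommutativeRing c ℓ) =
  Algebra.Solver.Ring ℤ.+-*-rawRing (fromCommutativeRing R) (FromInteger.homomorphism R)
    (FromInteger.fromℤ-≟ R)

module FieldProperties {q : ℕ} (F : FiniteField q) where
  open FiniteField F public

  commutativeRing : CommutativeRing 0ℓ 0ℓ
  commutativeRing = record { isCommutativeRing = isCommutativeRing }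

  open CommutativeRing commutativeRing public
    using (_-_; *-assoc; *-identityˡ; *-identityʳ; zeroˡ; zeroʳ)
  open RingSolver commutativeRing public
    using (Polynomial; solve; _:=_; _:+_; _:-_; _:*_; con)
  open CommutativeRing commutativeRing using (+-group)
  open import Algebra.Properties.Group +-group using (x∙y⁻¹≈ε⇒x≈y)
  open ≡-Reasoning

  :0 :1 : ∀ {n} → Polynomial n
  :0 = con (ℤ.+ 0)
  :1 = con (ℤ.+ 1)

  x-y≡0⇒x≡y : ∀ {x y} → x - y ≡ 0# → x ≡ y
  x-y≡0⇒x≡y = x∙y⁻¹≈ε⇒x≈y _ _

  x≢y⇒x-y≢0 : ∀ {x y} → x ≢ y → x - y ≢ 0#
  x≢y⇒x-y≢0 x≢y = x≢y ∘ x-y≡0⇒x≡y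

  x≡0⇒x*y≡0 : ∀ {x} y → x ≡ 0# → x * y ≡ 0#
  x≡0⇒x*y≡0 y x≡0 = trans (cong (_* y) x≡0) (zeroˡ y)

  *-inverse-cancel : ∀ {z w} x → z * w ≡ 1# → x * z * w ≡ x
  *-inverse-cancel {z} {w} x zw≡1 = begin
    x * z * w     ≡⟨ *-assoc x z w ⟩
    x * (z * w)   ≡⟨ cong (x *_) zw≡1 ⟩
    x * 1#        ≡⟨ *-identityʳ x ⟩
    x             ∎

  *-cancelʳ-≢0 : ∀ {x y z} → z ≢ 0# → x * z ≡ y * z → x ≡ y
  *-cancelʳ-≢0 {x} {y} {z} z≢0 xz≡yz = let (w , zw≡1) = inverse z z≢0 in begin
    x           ≡⟨ *-inverse-cancel x zw≡1 ⟨
    x * z * w   ≡⟨ cong (_* w) xz≡yz ⟩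
    y * z * w   ≡⟨ *-inverse-cancel y zw≡1 ⟩
    y           ∎

  divide : ∀ {a} → a ≢ 0# → ∀ b → ∃ λ x → x * a ≡ b
  divide {a} a≢0 b = let (w , aw≡1) = inverse a a≢0 in b * w , (begin
    b * w * a     ≡⟨ solve 3 (λ a b w → b :* w :* a := b :* a :* w) refl a b w ⟩
    b * a * w     ≡⟨ *-inverse-cancel b aw≡1 ⟩
    b             ∎)

module _ {A : Set} (_≟_ : DecidableEquality A) where
  open DecMembership _≟_ using (_∈?_)
  open ≡-Reasoning

  avoid : ∀ {n} (f : Fin n → A) → Injective _≡_ _≡_ f →
          (xs : List A) → length xs < n → ∃ λ i → f i ∉ xs
  avoid f f-injective xs |xs|<n with any? (λ i → ¬? (f i ∈? xs))
  ... | yes found = found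
  ... | no  none  =
    let (i , j , i<j , same-index) = pigeonhole |xs|<n (index ∘ hit)
    in  contradiction (f-injective (begin
          f i                         ≡⟨ lookup-index (hit i) ⟩
          lookup xs (index (hit i))   ≡⟨ cong (lookup xs) same-index ⟩
          lookup xs (index (hit j))   ≡⟨ lookup-index (hit j) ⟨
          f j                         ∎)) (<⇒≢ i<j)
    where
    hit : ∀ i → f i ∈ xs
    hit i = decidable-stable (f i ∈? xs) (λ fi∉xs → none (i , fi∉xs))

next-≢ : ∀ i → next i ≢ i
next-≢ zero ()
next-≢ (suc zero) ()
next-≢ (suc (suc zero)) ()

next³ : ∀ i → next (next (next i)) ≡ i
next³ zero             = refl
next³ (suc zero)       = refl
next³ (suc (suc zero)) = refl

next-orbit : ∀ i j → j ≡ i ⊎ j ≡ next i ⊎ j ≡ next (next i)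
next-orbit zero             zero             = inj₁ refl
next-orbit zero             (suc zero)       = inj₂ (inj₁ refl)
next-orbit zero             (suc (suc zero)) = inj₂ (inj₂ refl)
next-orbit (suc zero)       zero             = inj₂ (inj₂ refl)
next-orbit (suc zero)       (suc zero)       = inj₁ refl
next-orbit (suc zero)       (suc (suc zero)) = inj₂ (inj₁ refl)
next-orbit (suc (suc zero)) zero             = inj₂ (inj₁ refl)
next-orbit (suc (suc zero)) (suc zero)       = inj₂ (inj₂ refl)
next-orbit (suc (suc zero)) (suc (suc zero)) = inj₁ refl

module Walks (Δ : IncidenceSystem) where
  open IncidenceSystem Δ

  module Properties
    (≈-isEquivalence : IsEquivalence _≈_)
    (type-cong : ∀ {x y} → x ≈ y → type x ≡ type y)
    (*-respˡ-≈ : ∀ x x′ y → x ≈ x′ → x * y → x′ * y)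
    (*-sym : ∀ x y → x * y → y * x)
    where

    open IsEquivalence ≈-isEquivalence
      renaming (refl to ≈-refl; sym to ≈-sym; trans to ≈-trans)

    edge : ∀ {R x} y → R y → x * y → type x ≢ type y → Walk Δ R x y
    edge _ Ry x*y x≢y = step Ry x*y x≢y (stop ≈-refl)

    start-≈ : ∀ {R x x′ y} → x′ ≈ x → Walk Δ R x y → Walk Δ R x′ y
    start-≈ x′≈x (stop x≈y)           = stop (≈-trans x′≈x x≈y)
    start-≈ {x = x} {x′} x′≈x (step {y = y} Ry x*y x≢y w) =
      step Ry (*-respˡ-≈ x x′ y (≈-sym x′≈x) x*y) (x≢y ∘ trans (sym (type-cong x′≈x))) w

    infixr 5 _++_
    _++_ : ∀ {R x y z} → Walk Δ R x y → Walk Δ R y z → Walk Δ R x z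
    stop x≈y          ++ w′ = start-≈ x≈y w′
    step Ry x*y x≢y w ++ w′ = step Ry x*y x≢y (w ++ w′)

    reverse : ∀ {R x y} → R x → Walk Δ R x y → Walk Δ R y x
    reverse Rx (stop x≈y)          = stop (≈-sym x≈y)
    reverse {x = x} Rx (step {y = y} Ry x*y x≢y w) = reverse Ry w ++ edge x Rx (*-sym x y x*y) (x≢y ∘ sym)

module TriangleComplexProperties (Γ : Geometry) where
  open TriElem

  ≈T-isEquivalence : IsEquivalence (_≈T_ Γ)
  ≈T-isEquivalence = record
    { refl  = refl , refl , refl
    ; sym   = λ (p , l , t) → sym p , sym l , sym t
    ; trans = λ (p , l , t) (p′ , l′ , t′) → trans p p′ , trans l l′ , trans t t′
    }

  TriInc-respˡ : ∀ a a′ b → _≈T_ Γ a a′ → TriInc Γ a b → TriInc Γ a′ b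
  TriInc-respˡ (tri p L _ i) (tri .p .L _ .i) _ (refl , refl , refl) a*b = a*b

  TriInc-sym : ∀ a b → TriInc Γ a b → TriInc Γ b a
  TriInc-sym _ _ (inj₁ (p , l , t)) = inj₁ (sym p , sym l , sym t)
  TriInc-sym _ _ (inj₂ (inj₁ a→b))  = inj₂ (inj₂ a→b)
  TriInc-sym _ _ (inj₂ (inj₂ b→a))  = inj₂ (inj₁ b→a)

  TriStep⇒ty≢ : ∀ {a b} → TriStep Γ a b → ty a ≢ ty b
  TriStep⇒ty≢ {a} (b-next , _) a≡b = next-≢ (ty a) (trans (sym b-next) (sym a≡b))

  open Walks.Properties (TriangleComplex Γ)
    ≈T-isEquivalence (proj₂ ∘ proj₂) TriInc-respˡ TriInc-sym public

  forward : ∀ {R a} b → R b → TriStep Γ a b → Walk (TriangleComplex Γ) R a b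
  forward {a = a} b Rb a→b = edge b Rb (inj₂ (inj₁ a→b)) (TriStep⇒ty≢ {a} {b} a→b)

  backward : ∀ {R a} b → R b → TriStep Γ b a → Walk (TriangleComplex Γ) R a b
  backward {a = a} b Rb b→a = edge b Rb (inj₂ (inj₂ b→a)) (TriStep⇒ty≢ {b} {a} b→a ∘ sym)

module _ (Γ : Geometry) where
  open Geometry Γ

  Intersect : Line → Line → Set
  Intersect ℓ m = ∃ λ w → w I ℓ × w I m

record IsThickPlane (Γ : Geometry) : Set where
  open Geometry Γ
  field
    _≟ₚ_           : DecidableEquality Point
    join           : ∀ {x y} → x ≢ y → ∃ λ L → x I L × y I L
    join-unique    : ∀ {x y L M} → x ≢ y → x I L → y I L → x I M → y I M → L ≡ M
    point-avoiding : ∀ L x y → ∃ λ u → u I L × u ≢ x × u ≢ y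
    line-avoiding  : ∀ p L M → ∃ λ N → p I N × N ≢ L × N ≢ M
    transversal    : ∀ b L ℓ ℓ′ → ∃ λ m → b I m × m ≢ L × Intersect Γ m ℓ × Intersect Γ m ℓ′

module Connectivity {Γ : Geometry} (plane : IsThickPlane Γ) where
  open Geometry Γ
  open IsThickPlane plane
  open TriElem
  open TriangleComplexProperties Γ

  Δ : IncidenceSystem
  Δ = TriangleComplex Γ

  meet-exactly : ∀ {p L M} → L ≢ M → p I L → p I M → MeetExactly Γ L M p
  meet-exactly {p} {L} {M} L≢M pL pM = pL , pM , only-p
    where
    only-p : ∀ x → x I L → x I M → x ≡ p
    only-p x xL xM with x ≟ₚ p
    ... | yes x≡p = x≡p
    ... | no  x≢p = ⊥-elim (L≢M (join-unique x≢p xL pL xM pM))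

  unique-intersection : ∀ {x y L M} → L ≢ M → x I L → x I M → y I L → y I M → x ≡ y
  unique-intersection L≢M xL xM yL yM = proj₂ (proj₂ (meet-exactly L≢M yL yM)) _ xL xM

  meet-off-line : ∀ {u α β ℓ m L} → β ≢ α → m ≢ L → ℓ ≢ L →
                  β I m → β I L → α I ℓ → α I L → u I m → u I ℓ → ¬ u I L
  meet-off-line β≢α m≢L ℓ≢L βm βL αℓ αL um uℓ uL =
    β≢α (trans (unique-intersection m≢L βm βL um uL) (unique-intersection ℓ≢L uℓ uL αℓ αL))

  step-between : ∀ {p x L M j} i (pL : p I L) (pM : p I M) (xM : x I M) →
                 j ≡ next i → L ≢ M → p ≢ x → TriStep Γ (tri p L pL i) (tri x M xM j)
  step-between _ pL pM xM j≡next L≢M p≢x = j≡next , meet-exactly L≢M pL pM , p≢x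

  common-successor : ∀ {p L L′} (pL : p I L) (pL′ : p I L′) i →
    ∃ λ e → TriStep Γ (tri p L pL i) e × TriStep Γ (tri p L′ pL′ i) e
  common-successor {p} {L} {L′} pL pL′ i with line-avoiding p L L′
  ... | M , pM , M≢L , M≢L′ with point-avoiding M p p
  ... | x , xM , x≢p , _ =
    tri x M xM (next i) ,
    step-between i pL  pM xM refl (M≢L  ∘ sym) (x≢p ∘ sym) ,
    step-between i pL′ pM xM refl (M≢L′ ∘ sym) (x≢p ∘ sym)

  common-predecessor : ∀ {p p′ L} (pL : p I L) (p′L : p′ I L) i →
    ∃ λ e → TriStep Γ e (tri p L pL i) × TriStep Γ e (tri p′ L p′L i)
  common-predecessor {p} {p′} {L} pL p′L i with point-avoiding L p p′
  ... | v , vL , v≢p , v≢p′ with line-avoiding v L L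
  ... | N , vN , N≢L , _ =
    tri v N vN (next (next i)) ,
    step-between _ vN vL pL  (sym (next³ i)) N≢L v≢p ,
    step-between _ vN vL p′L (sym (next³ i)) N≢L v≢p′

  Whole : TriElem Γ → Set
  Whole = InResidue Δ []

  ∈Whole : ∀ e → Whole e
  ∈Whole _ = [] , λ ()

  forward-whole : ∀ {a} b → TriStep Γ a b → Walk Δ Whole a b
  forward-whole b = forward b (∈Whole b)

  backward-whole : ∀ {a} b → TriStep Γ b a → Walk Δ Whole a b
  backward-whole b = backward b (∈Whole b)

  same-point : ∀ {p L L′ i} (pL : p I L) (pL′ : p I L′) → Walk Δ Whole (tri p L pL i) (tri p L′ pL′ i)
  same-point {i = i} pL pL′ with common-successor pL pL′ i
  ... | e , s , s′ = forward-whole e s ++ backward-whole _ s′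

  same-line : ∀ {p p′ L i} (pL : p I L) (p′L : p′ I L) → Walk Δ Whole (tri p L pL i) (tri p′ L p′L i)
  same-line {i = i} pL p′L with common-predecessor pL p′L i
  ... | e , s , s′ = backward-whole e s ++ forward-whole _ s′

  same-type : ∀ {x y} → ty x ≡ ty y → Walk Δ Whole x y
  same-type {tri p L pL i} {tri p′ L′ p′L′ .i} refl with p ≟ₚ p′
  ... | yes refl = same-point pL p′L′
  ... | no p≢p′ with join p≢p′
  ... | K , pK , p′K = same-point pL pK ++ same-line pK p′K ++ same-point p′K p′L′

  step-to-next-type : ∀ e → ∃ λ e′ → ty e′ ≡ next (ty e) × Walk Δ Whole e e′
  step-to-next-type (tri p L pL i) with common-successor pL pL i
  ... | e′ , s , _ = e′ , proj₁ s , forward-whole e′ s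

  walk-to-type : ∀ e j → ∃ λ e′ → ty e′ ≡ j × Walk Δ Whole e e′
  walk-to-type e j with next-orbit (ty e) j
  ... | inj₁ refl        = e , refl , stop (refl , refl , refl)
  ... | inj₂ (inj₁ refl) = step-to-next-type e
  ... | inj₂ (inj₂ refl) with step-to-next-type e
  ... | e₁ , t₁ , w₁ with step-to-next-type e₁
  ... | e₂ , t₂ , w₂ = e₂ , trans t₂ (cong next t₁) , w₁ ++ w₂

  Δ-connected : ConnectedOn Δ Whole
  Δ-connected x y _ _ with walk-to-type x (ty y)
  ... | x′ , ty-x′ , x→x′ = x→x′ ++ same-type ty-x′

  module Residue {p L} (pL : p I L) (i : Fin 3) where
    f : TriElem Γ
    f = tri p L pL i

    R : TriElem Γ → Set
    R = InResidue Δ (f ∷ [])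

    ∈R : ∀ {e} → TriInc Γ e f → ty e ≢ ty f → R e
    ∈R e*f e≢f = e*f ∷ [] , λ { (here (_ , _ , ty≡)) → e≢f ty≡ ; (there ()) }

    successor∈R : ∀ {a} → TriStep Γ f a → R a
    successor∈R {a} f→a = ∈R {a} (inj₂ (inj₂ f→a)) (TriStep⇒ty≢ {f} {a} f→a ∘ sym)

    predecessor∈R : ∀ {b} → TriStep Γ b f → R b
    predecessor∈R {b} b→f = ∈R {b} (inj₂ (inj₁ b→f)) (TriStep⇒ty≢ {b} {f} b→f)

    successor-off-L : ∀ {a} → TriStep Γ f a → ¬ pt a I L
    successor-off-L {a} (_ , (_ , _ , only-p) , p≢a) aL = p≢a (sym (only-p (pt a) aL (inc a)))

    p-off-predecessor : ∀ {b} → TriStep Γ b f → ¬ p I ln b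
    p-off-predecessor (_ , (_ , _ , only-b) , b≢p) p∈b = b≢p (sym (only-b p p∈b pL))

    predecessor-line≢L : ∀ {b} → TriStep Γ b f → ln b ≢ L
    predecessor-line≢L {b} b→f b≡L = p-off-predecessor {b} b→f (subst (p I_) (sym b≡L) pL)

    successor→predecessor : ∀ {a b} → TriStep Γ f a → TriStep Γ b f → pt a I ln b → TriStep Γ a b
    successor→predecessor {a} {b} f→a@(a-next , (_ , p∈a , _) , _) b→f@(f-next , (_ , b∈L , _) , _) a∈b =
      ty-next , meet-exactly lines≢ (inc a) a∈b ,
      λ a≡b → successor-off-L {a} f→a (subst (_I L) (sym a≡b) b∈L)
      where
      ty-next : ty b ≡ next (ty a)
      ty-next = sym (trans (cong next a-next) (trans (cong (next ∘ next) f-next) (next³ (ty b))))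
      lines≢ : ln a ≢ ln b
      lines≢ a≡b = p-off-predecessor {b} b→f (subst (p I_) a≡b p∈a)

    predecessor-at : ∀ {v N} (vN : v I N) → v I L → v ≢ p → N ≢ L →
                     TriStep Γ (tri v N vN (next (next i))) f
    predecessor-at vN vL v≢p N≢L = step-between _ vN vL pL (sym (next³ i)) N≢L v≢p

    p≢off-L : ∀ {w} → ¬ w I L → p ≢ w
    p≢off-L w∉L p≡w = w∉L (subst (_I L) p≡w pL)

    line-to : ∀ {w} → ¬ w I L → ∃ λ K → p I K × w I K
    line-to w∉L = join (p≢off-L w∉L)

    successor-at : ∀ {w} → ¬ w I L → TriElem Γ
    successor-at {w} w∉L = tri w (proj₁ (line-to w∉L)) (proj₂ (proj₂ (line-to w∉L))) (next i)

    successor-at-step : ∀ {w} (w∉L : ¬ w I L) → TriStep Γ f (successor-at w∉L)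
    successor-at-step {w} w∉L =
      let (K , pK , wK) = line-to w∉L
      in  step-between i pL pK wK refl (λ L≡K → w∉L (subst (w I_) (sym L≡K) wK)) (p≢off-L w∉L)

    successors-linked : ∀ a a′ b → TriStep Γ f a → TriStep Γ f a′ → TriStep Γ b f →
                        pt a I ln b → pt a′ I ln b → Walk Δ R a a′
    successors-linked a a′ b f→a f→a′ b→f a∈b a′∈b =
      forward b (predecessor∈R {b} b→f) (successor→predecessor {a} {b} f→a b→f a∈b) ++
      backward a′ (successor∈R {a′} f→a′) (successor→predecessor {a′} {b} f→a′ b→f a′∈b)

    successor≢on-L : ∀ {e x} → TriStep Γ f e → x I L → pt e ≢ x
    successor≢on-L {e} f→e xL e≡x = successor-off-L {e} f→e (subst (_I L) (sym e≡x) xL)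

    successor-line≢L : ∀ {e ℓ} → TriStep Γ f e → pt e I ℓ → ℓ ≢ L
    successor-line≢L {e} f→e eℓ ℓ≡L = successor-off-L {e} f→e (subst (pt e I_) ℓ≡L eℓ)

    successors-connected : ∀ {a a′} → TriStep Γ f a → TriStep Γ f a′ → Walk Δ R a a′
    successors-connected {a} {a′} f→a f→a′ =
      let (α , αL , α≢p , _)  = point-avoiding L p p
          (β , βL , β≢p , β≢α) = point-avoiding L p α
          (ℓ  , aℓ  , αℓ)  = join (successor≢on-L {a}  f→a  αL)
          (ℓ′ , a′ℓ′ , αℓ′) = join (successor≢on-L {a′} f→a′ αL)
          ℓ≢L  = successor-line≢L {a}  f→a  aℓ
          ℓ′≢L = successor-line≢L {a′} f→a′ a′ℓ′
          (m , βm , m≢L , (w , wm , wℓ) , (w′ , w′m , w′ℓ′)) = transversal β L ℓ ℓ′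
          w∉L  = meet-off-line β≢α m≢L ℓ≢L  βm βL αℓ  αL wm  wℓ
          w′∉L = meet-off-line β≢α m≢L ℓ′≢L βm βL αℓ′ αL w′m w′ℓ′
      in  successors-linked a (successor-at w∉L) (tri α ℓ αℓ (next (next i)))
            f→a (successor-at-step w∉L) (predecessor-at αℓ αL α≢p ℓ≢L) aℓ wℓ
       ++ successors-linked (successor-at w∉L) (successor-at w′∉L) (tri β m βm (next (next i)))
            (successor-at-step w∉L) (successor-at-step w′∉L) (predecessor-at βm βL β≢p m≢L) wm w′m
       ++ successors-linked (successor-at w′∉L) a′ (tri α ℓ′ αℓ′ (next (next i)))
            (successor-at-step w′∉L) f→a′ (predecessor-at αℓ′ αL α≢p ℓ′≢L) w′ℓ′ a′ℓ′

    reach-successor : ∀ {e} → R e → ∃ λ a → TriStep Γ f a × Walk Δ R e a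
    reach-successor (inj₁ e≈f ∷ [] , e∉F) = ⊥-elim (e∉F (here e≈f))
    reach-successor {e} (inj₂ (inj₂ f→e) ∷ [] , _) = e , f→e , stop (refl , refl , refl)
    reach-successor {b} (inj₂ (inj₁ b→f@(_ , (_ , b∈L , _) , _)) ∷ [] , _) =
      let (z , z∈b , z≢b , _) = point-avoiding (ln b) (pt b) (pt b)
          z∉L : ¬ z I L
          z∉L zL = z≢b (unique-intersection (predecessor-line≢L {b} b→f) z∈b zL (inc b) b∈L)
      in  successor-at z∉L , successor-at-step z∉L ,
          backward (successor-at z∉L) (successor∈R {successor-at z∉L} (successor-at-step z∉L))
            (successor→predecessor {successor-at z∉L} {b} (successor-at-step z∉L) b→f z∈b)

    residue-connected : ConnectedOn Δ R
    residue-connected x y x∈R y∈R =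
      let (a  , f→a  , x→a)  = reach-successor {x} x∈R
          (a′ , f→a′ , y→a′) = reach-successor {y} y∈R
      in  x→a ++ successors-connected {a} {a′} f→a f→a′ ++ reverse y∈R y→a′

  residually-connected : ResiduallyConnected Δ
  residually-connected []                   _ _    = Δ-connected
  residually-connected (tri p L pL i ∷ [])  _ _    = Residue.residue-connected pL i
  residually-connected (_ ∷ _ ∷ F)          _ rank =
    contradiction (≤-trans rank (m∸n≤m 1 (length F))) λ { (s≤s ()) }

module AffinePlane {q : ℕ} (F : FiniteField q) (3≤q : 3 ≤ q) where
  open FieldProperties F
  open Geometry (AG F)
  open ≡-Reasoning

  _≟ₚ_ : DecidableEquality Point
  _≟ₚ_ = Product.≡-dec _≟ᶠ_ _≟ᶠ_

  Direction : Set
  Direction = Fin q ⊎ ⊤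

  _≟ᵈ_ : DecidableEquality Direction
  _≟ᵈ_ = Sum.≡-dec _≟ᶠ_ Unit._≟_

  direction : Line → Direction
  direction (inj₁ (m , _)) = inj₁ m
  direction (inj₂ _)       = inj₂ tt

  line-through : Direction → Point → Line
  line-through (inj₁ m) (x , y) = inj₁ (m , y - m * x)
  line-through (inj₂ _) (x , _) = inj₂ x

  line-through-I : ∀ d b → b I line-through d b
  line-through-I (inj₁ m) (x , y) = solve 3 (λ m x y → y := m :* x :+ (y :- m :* x)) refl m x y
  line-through-I (inj₂ _) _       = refl

  direction-line-through : ∀ d b → direction (line-through d b) ≡ d
  direction-line-through (inj₁ _)  _ = refl
  direction-line-through (inj₂ tt) _ = refl

  line-through-≢ : ∀ {d b L} → d ≢ direction L → line-through d b ≢ L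
  line-through-≢ {d} {b} d≢ L≡ = d≢ (trans (sym (direction-line-through d b)) (cong direction L≡))

  line-through-direction : ∀ {b L} → b I L → line-through (direction L) b ≡ L
  line-through-direction {x , y} {inj₁ (m , c)} y≡ = cong (λ c′ → inj₁ (m , c′)) (begin
    y - m * x           ≡⟨ cong (λ y → y - m * x) y≡ ⟩
    m * x + c - m * x   ≡⟨ solve 3 (λ m x c → m :* x :+ c :- m :* x := c) refl m x c ⟩
    c                   ∎)
  line-through-direction {L = inj₂ _} x≡ = cong inj₂ x≡

  same-abscissa : ∀ {x₁ y₁ x₂ y₂ m c} → (x₁ , y₁) I inj₁ (m , c) → (x₂ , y₂) I inj₁ (m , c) →
                  x₁ ≡ x₂ → (x₁ , y₁) ≡ (x₂ , y₂)
  same-abscissa y₁≡ y₂≡ refl = cong (_ ,_) (trans y₁≡ (sym y₂≡))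

  slope : ∀ {x₁ y₁ x₂ y₂ m c} → (x₁ , y₁) I inj₁ (m , c) → (x₂ , y₂) I inj₁ (m , c) →
          m * (x₂ - x₁) ≡ y₂ - y₁
  slope {x₁} {_} {x₂} {_} {m} {c} refl refl =
    solve 4 (λ m c x₁ x₂ → m :* (x₂ :- x₁) := m :* x₂ :+ c :- (m :* x₁ :+ c)) refl m c x₁ x₂

  direction-unique : ∀ {x y L M} → x ≢ y → x I L → y I L → x I M → y I M →
                     direction L ≡ direction M
  direction-unique {L = inj₂ _} {inj₂ _} _ _ _ _ _ = refl
  direction-unique {L = inj₁ _} {inj₂ _} x≢y xL yL xM yM =
    ⊥-elim (x≢y (same-abscissa xL yL (trans xM (sym yM))))
  direction-unique {L = inj₂ _} {inj₁ _} x≢y xL yL xM yM =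
    ⊥-elim (x≢y (same-abscissa xM yM (trans xL (sym yL))))
  direction-unique {x₁ , _} {x₂ , _} {inj₁ _} {inj₁ _} x≢y xL yL xM yM with x₁ ≟ᶠ x₂
  ... | yes x₁≡x₂ = ⊥-elim (x≢y (same-abscissa xL yL x₁≡x₂))
  ... | no  x₁≢x₂ = cong inj₁ (*-cancelʳ-≢0 (x≢y⇒x-y≢0 (x₁≢x₂ ∘ sym))
                                 (trans (slope xL yL) (sym (slope xM yM))))

  join-unique : ∀ {x y L M} → x ≢ y → x I L → y I L → x I M → y I M → L ≡ M
  join-unique {x} {L = L} {M} x≢y xL yL xM yM = begin
    L                             ≡⟨ line-through-direction xL ⟨
    line-through (direction L) x  ≡⟨ cong (λ d → line-through d x) (direction-unique x≢y xL yL xM yM) ⟩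
    line-through (direction M) x  ≡⟨ line-through-direction xM ⟩
    M                             ∎

  slope-line-I : ∀ {x₁ y₁ x₂ y₂ s} → s * (x₂ - x₁) ≡ y₂ - y₁ →
                 (x₂ , y₂) I line-through (inj₁ s) (x₁ , y₁)
  slope-line-I {x₁} {y₁} {x₂} {y₂} {s} s[x₂-x₁]≡y₂-y₁ = begin
    y₂                        ≡⟨ solve 2 (λ y₁ y₂ → y₂ := (y₂ :- y₁) :+ y₁) refl y₁ y₂ ⟩
    (y₂ - y₁) + y₁            ≡⟨ cong (_+ y₁) s[x₂-x₁]≡y₂-y₁ ⟨
    s * (x₂ - x₁) + y₁        ≡⟨ expand ⟩
    s * x₂ + (y₁ - s * x₁)    ∎
    where
    expand : s * (x₂ - x₁) + y₁ ≡ s * x₂ + (y₁ - s * x₁)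
    expand = solve 4 (λ s x₁ x₂ y₁ → s :* (x₂ :- x₁) :+ y₁ := s :* x₂ :+ (y₁ :- s :* x₁))
               refl s x₁ x₂ y₁

  join : ∀ {x y} → x ≢ y → ∃ λ L → x I L × y I L
  join {x₁ , y₁} {x₂ , y₂} x≢y with x₁ ≟ᶠ x₂
  ... | yes x₁≡x₂ = inj₂ x₁ , refl , sym x₁≡x₂
  ... | no  x₁≢x₂ =
    let (s , s[x₂-x₁]≡y₂-y₁) = divide (x≢y⇒x-y≢0 (x₁≢x₂ ∘ sym)) (y₂ - y₁)
    in  line-through (inj₁ s) (x₁ , y₁) , line-through-I (inj₁ s) (x₁ , y₁) ,
        slope-line-I s[x₂-x₁]≡y₂-y₁

  crossing : ∀ {s c t d x} → x * (s - t) ≡ d - c → s * x + c ≡ t * x + d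
  crossing {s} {c} {t} {d} {x} x[s-t]≡d-c = begin
    s * x + c                 ≡⟨ solve 4 (λ s c t x → s :* x :+ c := t :* x :+ c :+ x :* (s :- t)) refl s c t x ⟩
    t * x + c + x * (s - t)   ≡⟨ cong (t * x + c +_) x[s-t]≡d-c ⟩
    t * x + c + (d - c)       ≡⟨ solve 4 (λ c t d x → t :* x :+ c :+ (d :- c) := t :* x :+ d) refl c t d x ⟩
    t * x + d                 ∎

  meet : ∀ ℓ m → direction ℓ ≢ direction m → Intersect (AG F) ℓ m
  meet (inj₂ _)       (inj₂ _)       ℓ∦m = ⊥-elim (ℓ∦m refl)
  meet (inj₂ c)       (inj₁ (t , d)) _   = (c , t * c + d) , refl , refl
  meet (inj₁ (s , c)) (inj₂ d)       _   = (d , s * d + c) , refl , refl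
  meet (inj₁ (s , c)) (inj₁ (t , d)) ℓ∦m =
    let (x , x[s-t]≡d-c) = divide (x≢y⇒x-y≢0 (ℓ∦m ∘ cong inj₁)) (d - c)
    in  (x , s * x + c) , refl , crossing x[s-t]≡d-c

  point-on : Line → Fin q → Point
  point-on (inj₁ (m , c)) x = x , m * x + c
  point-on (inj₂ c)       y = c , y

  point-on-I : ∀ L t → point-on L t I L
  point-on-I (inj₁ _) _ = refl
  point-on-I (inj₂ _) _ = refl

  point-on-injective : ∀ L → Injective _≡_ _≡_ (point-on L)
  point-on-injective (inj₁ _) = cong proj₁
  point-on-injective (inj₂ _) = cong proj₂

  direction-of : Fin (suc q) → Direction
  direction-of zero    = inj₂ tt
  direction-of (suc m) = inj₁ m

  direction-of-injective : Injective _≡_ _≡_ direction-of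
  direction-of-injective {zero}  {zero}  _    = refl
  direction-of-injective {suc _} {suc _} refl = refl

  isThickPlane : IsThickPlane (AG F)
  isThickPlane = record
    { _≟ₚ_           = _≟ₚ_
    ; join           = join
    ; join-unique    = join-unique
    ; point-avoiding = point-avoiding
    ; line-avoiding  = line-avoiding
    ; transversal    = transversal
    }
    where
    point-avoiding : ∀ L x y → ∃ λ u → u I L × u ≢ x × u ≢ y
    point-avoiding L x y =
      let (t , t∉) = avoid _≟ₚ_ (point-on L) (point-on-injective L) (x ∷ y ∷ []) 3≤q
      in  point-on L t , point-on-I L t , t∉ ∘ here , t∉ ∘ there ∘ here

    line-avoiding : ∀ p L M → ∃ λ N → p I N × N ≢ L × N ≢ M
    line-avoiding p L M =
      let (k , k∉) = avoid _≟ᵈ_ direction-of direction-of-injective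
                       (direction L ∷ direction M ∷ []) (m≤n⇒m≤1+n 3≤q)
      in  line-through (direction-of k) p , line-through-I _ p ,
          line-through-≢ (k∉ ∘ here) , line-through-≢ (k∉ ∘ there ∘ here)

    transversal : ∀ b L ℓ ℓ′ → ∃ λ m → b I m × m ≢ L × Intersect (AG F) m ℓ × Intersect (AG F) m ℓ′
    transversal b L ℓ ℓ′ =
      let (k , k∉) = avoid _≟ᵈ_ direction-of direction-of-injective
                       (direction L ∷ direction ℓ ∷ direction ℓ′ ∷ []) (s≤s 3≤q)
          m = line-through (direction-of k) b
          m-direction = direction-line-through (direction-of k) b
      in  m , line-through-I _ b , line-through-≢ (k∉ ∘ here) ,
          meet m ℓ  (k∉ ∘ there ∘ here ∘ trans (sym m-direction)) ,
          meet m ℓ′ (k∉ ∘ there ∘ there ∘ here ∘ trans (sym m-direction))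

module ProjectivePlane {q : ℕ} (F : FiniteField q) (2≤q : 2 ≤ q) where
  open FieldProperties F
  open Geometry (PG F)
  open ≡-Reasoning

  _≟ₚ_ : DecidableEquality (Proj q)
  _≟ₚ_ = Sum.≡-dec (Product.≡-dec _≟ᶠ_ _≟ᶠ_) (Sum.≡-dec _≟ᶠ_ Unit._≟_)

  Vec3 : Set
  Vec3 = Fin q × Fin q × Fin q

  𝟎 : Vec3
  𝟎 = 0# , 0# , 0#

  _!_ : Vec3 → Fin 3 → Fin q
  (v₀ , _  , _ ) ! zero             = v₀
  (_  , v₁ , _ ) ! suc zero         = v₁
  (_  , _  , v₂) ! suc (suc zero)   = v₂

  _·_ : Vec3 → Vec3 → Fin q
  (x₀ , x₁ , x₂) · (l₀ , l₁ , l₂) = x₀ * l₀ + x₁ * l₁ + x₂ * l₂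

  _✕_ : Vec3 → Vec3 → Vec3
  (u₀ , u₁ , u₂) ✕ (v₀ , v₁ , v₂) = u₁ * v₂ - u₂ * v₁ , u₂ * v₀ - u₀ * v₂ , u₀ * v₁ - u₁ * v₀

  _∥_ : Vec3 → Vec3 → Set
  u ∥ v = ∀ i j → u ! i * v ! j ≡ u ! j * v ! i

  coordinates : Proj q → Vec3
  coordinates (inj₁ (a , b))   = 1# , a , b
  coordinates (inj₂ (inj₁ a))  = 0# , 1# , a
  coordinates (inj₂ (inj₂ tt)) = 0# , 0# , 1#

  -- PG's incidence uses coordinates local to Defs, which agree with these constructor-wise.
  incidence : ∀ p L → (p I L) ≡ (coordinates p · coordinates L ≡ 0#)
  incidence (inj₁ _)          (inj₁ _)          = refl
  incidence (inj₁ _)          (inj₂ (inj₁ _))   = refl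
  incidence (inj₁ _)          (inj₂ (inj₂ tt))  = refl
  incidence (inj₂ (inj₁ _))   (inj₁ _)          = refl
  incidence (inj₂ (inj₁ _))   (inj₂ (inj₁ _))   = refl
  incidence (inj₂ (inj₁ _))   (inj₂ (inj₂ tt))  = refl
  incidence (inj₂ (inj₂ tt))  (inj₁ _)          = refl
  incidence (inj₂ (inj₂ tt))  (inj₂ (inj₁ _))   = refl
  incidence (inj₂ (inj₂ tt))  (inj₂ (inj₂ tt))  = refl

  ·≡0⇒I : ∀ {p L} → coordinates p · coordinates L ≡ 0# → p I L
  ·≡0⇒I {p} {L} = subst id (sym (incidence p L))

  I⇒·≡0 : ∀ {p L} → p I L → coordinates p · coordinates L ≡ 0#
  I⇒·≡0 {p} {L} = subst id (incidence p L)

  ·-comm : ∀ u v → u · v ≡ v · u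
  ·-comm (u₀ , u₁ , u₂) (v₀ , v₁ , v₂) = solve 6
    (λ u₀ u₁ u₂ v₀ v₁ v₂ → u₀ :* v₀ :+ u₁ :* v₁ :+ u₂ :* v₂ := v₀ :* u₀ :+ v₁ :* u₁ :+ v₂ :* u₂)
    refl u₀ u₁ u₂ v₀ v₁ v₂

  I-sym : ∀ {p L} → p I L → L I p
  I-sym {p} {L} pL = ·≡0⇒I {L} {p} (trans (·-comm (coordinates L) (coordinates p)) (I⇒·≡0 {p} {L} pL))

  ·-✕ˡ : ∀ u v → u · (u ✕ v) ≡ 0#
  ·-✕ˡ (u₀ , u₁ , u₂) (v₀ , v₁ , v₂) = solve 6 (λ u₀ u₁ u₂ v₀ v₁ v₂ →
    u₀ :* (u₁ :* v₂ :- u₂ :* v₁) :+ u₁ :* (u₂ :* v₀ :- u₀ :* v₂) :+ u₂ :* (u₀ :* v₁ :- u₁ :* v₀) := :0)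
    refl u₀ u₁ u₂ v₀ v₁ v₂

  ·-✕ʳ : ∀ u v → v · (u ✕ v) ≡ 0#
  ·-✕ʳ (u₀ , u₁ , u₂) (v₀ , v₁ , v₂) = solve 6 (λ u₀ u₁ u₂ v₀ v₁ v₂ →
    v₀ :* (u₁ :* v₂ :- u₂ :* v₁) :+ v₁ :* (u₂ :* v₀ :- u₀ :* v₂) :+ v₂ :* (u₀ :* v₁ :- u₁ :* v₀) := :0)
    refl u₀ u₁ u₂ v₀ v₁ v₂

  ∥-from-minors : ∀ {u₀ u₁ u₂ v₀ v₁ v₂} →
    u₁ * v₂ ≡ u₂ * v₁ → u₂ * v₀ ≡ u₀ * v₂ → u₀ * v₁ ≡ u₁ * v₀ → (u₀ , u₁ , u₂) ∥ (v₀ , v₁ , v₂)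
  ∥-from-minors m₀ m₁ m₂ zero             zero             = refl
  ∥-from-minors m₀ m₁ m₂ zero             (suc zero)       = m₂
  ∥-from-minors m₀ m₁ m₂ zero             (suc (suc zero)) = sym m₁
  ∥-from-minors m₀ m₁ m₂ (suc zero)       zero             = sym m₂
  ∥-from-minors m₀ m₁ m₂ (suc zero)       (suc zero)       = refl
  ∥-from-minors m₀ m₁ m₂ (suc zero)       (suc (suc zero)) = m₀
  ∥-from-minors m₀ m₁ m₂ (suc (suc zero)) zero             = m₁
  ∥-from-minors m₀ m₁ m₂ (suc (suc zero)) (suc zero)       = sym m₀
  ∥-from-minors m₀ m₁ m₂ (suc (suc zero)) (suc (suc zero)) = refl

  ✕≡𝟎⇒∥ : ∀ u v → u ✕ v ≡ 𝟎 → u ∥ v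
  ✕≡𝟎⇒∥ (u₀ , u₁ , u₂) (v₀ , v₁ , v₂) u✕v≡𝟎 = ∥-from-minors
    (x-y≡0⇒x≡y (cong proj₁ u✕v≡𝟎))
    (x-y≡0⇒x≡y (cong (proj₁ ∘ proj₂) u✕v≡𝟎))
    (x-y≡0⇒x≡y (cong (proj₂ ∘ proj₂) u✕v≡𝟎))

  a*0-b*0 : ∀ {x y} a b → x ≡ 0# → y ≡ 0# → a * x - b * y ≡ 0#
  a*0-b*0 {x} {y} a b refl refl = solve 2 (λ a b → a :* :0 :- b :* :0 := :0) refl a b

  -- u ✕ (a ✕ b) = (u · b) a - (u · a) b, one component at a time.
  ⊥⇒∥✕ : ∀ {u a b} → u · a ≡ 0# → u · b ≡ 0# → u ∥ (a ✕ b)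
  ⊥⇒∥✕ {u₀ , u₁ , u₂} {a₀ , a₁ , a₂} {b₀ , b₁ , b₂} u·a≡0 u·b≡0 = ✕≡𝟎⇒∥ _ _ (cong₂ _,_
    (trans (solve 9 (λ u₀ u₁ u₂ a₀ a₁ a₂ b₀ b₁ b₂ →
        u₁ :* (a₀ :* b₁ :- a₁ :* b₀) :- u₂ :* (a₂ :* b₀ :- a₀ :* b₂)
        := a₀ :* (u₀ :* b₀ :+ u₁ :* b₁ :+ u₂ :* b₂) :- b₀ :* (u₀ :* a₀ :+ u₁ :* a₁ :+ u₂ :* a₂))
      refl u₀ u₁ u₂ a₀ a₁ a₂ b₀ b₁ b₂) (a*0-b*0 a₀ b₀ u·b≡0 u·a≡0))
    (cong₂ _,_
    (trans (solve 9 (λ u₀ u₁ u₂ a₀ a₁ a₂ b₀ b₁ b₂ →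
        u₂ :* (a₁ :* b₂ :- a₂ :* b₁) :- u₀ :* (a₀ :* b₁ :- a₁ :* b₀)
        := a₁ :* (u₀ :* b₀ :+ u₁ :* b₁ :+ u₂ :* b₂) :- b₁ :* (u₀ :* a₀ :+ u₁ :* a₁ :+ u₂ :* a₂))
      refl u₀ u₁ u₂ a₀ a₁ a₂ b₀ b₁ b₂) (a*0-b*0 a₁ b₁ u·b≡0 u·a≡0))
    (trans (solve 9 (λ u₀ u₁ u₂ a₀ a₁ a₂ b₀ b₁ b₂ →
        u₀ :* (a₂ :* b₀ :- a₀ :* b₂) :- u₁ :* (a₁ :* b₂ :- a₂ :* b₁)
        := a₂ :* (u₀ :* b₀ :+ u₁ :* b₁ :+ u₂ :* b₂) :- b₂ :* (u₀ :* a₀ :+ u₁ :* a₁ :+ u₂ :* a₂))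
      refl u₀ u₁ u₂ a₀ a₁ a₂ b₀ b₁ b₂) (a*0-b*0 a₂ b₂ u·b≡0 u·a≡0))))

  ∥-trans : ∀ {u v c} k → c ! k ≢ 0# → u ∥ c → v ∥ c → u ∥ v
  ∥-trans {u} {v} {c} k cₖ≢0 u∥c v∥c i j = *-cancelʳ-≢0 cₖ≢0 (*-cancelʳ-≢0 cₖ≢0 (begin
    u ! i * v ! j * c ! k * c ! k        ≡⟨ regroup (u ! i) (v ! j) (c ! k) ⟩
    (u ! i * c ! k) * (v ! j * c ! k)    ≡⟨ cong₂ _*_ (u∥c i k) (v∥c j k) ⟩
    (u ! k * c ! i) * (v ! k * c ! j)    ≡⟨ interchange (u ! k) (v ! k) (c ! i) (c ! j) ⟩
    (u ! k * c ! j) * (v ! k * c ! i)    ≡⟨ cong₂ _*_ (u∥c j k) (v∥c i k) ⟨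
    (u ! j * c ! k) * (v ! i * c ! k)    ≡⟨ regroup (u ! j) (v ! i) (c ! k) ⟨
    u ! j * v ! i * c ! k * c ! k        ∎))
    where
    regroup : ∀ x y z → x * y * z * z ≡ (x * z) * (y * z)
    regroup = solve 3 (λ x y z → x :* y :* z :* z := (x :* z) :* (y :* z)) refl
    interchange : ∀ a b x y → (a * x) * (b * y) ≡ (a * y) * (b * x)
    interchange = solve 4 (λ a b x y → (a :* x) :* (b :* y) := (a :* y) :* (b :* x)) refl

  1*x≡y*1⇒y≡x : ∀ {x y} → 1# * x ≡ y * 1# → y ≡ x
  1*x≡y*1⇒y≡x {x} {y} e = trans (sym (*-identityʳ y)) (trans (sym e) (*-identityˡ x))

  1*1≢x*0 : ∀ x → 1# * 1# ≢ x * 0#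
  1*1≢x*0 x e = 0≢1 (sym (trans (sym (*-identityʳ 1#)) (trans e (zeroʳ x))))

  1*1≢0*x : ∀ x → 1# * 1# ≢ 0# * x
  1*1≢0*x x e = 0≢1 (sym (trans (sym (*-identityʳ 1#)) (trans e (zeroˡ x))))

  ∥⇒≡ : ∀ {x y} → coordinates x ∥ coordinates y → x ≡ y
  ∥⇒≡ {inj₁ _}          {inj₁ _}          x∥y =
    cong inj₁ (cong₂ _,_ (1*x≡y*1⇒y≡x (x∥y (# 0) (# 1))) (1*x≡y*1⇒y≡x (x∥y (# 0) (# 2))))
  ∥⇒≡ {inj₁ (a , _)}    {inj₂ (inj₁ _)}   x∥y = ⊥-elim (1*1≢x*0 a (x∥y (# 0) (# 1)))
  ∥⇒≡ {inj₁ (_ , b)}    {inj₂ (inj₂ tt)}  x∥y = ⊥-elim (1*1≢x*0 b (x∥y (# 0) (# 2)))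
  ∥⇒≡ {inj₂ (inj₁ _)}   {inj₁ (a , _)}    x∥y = ⊥-elim (1*1≢0*x a (x∥y (# 1) (# 0)))
  ∥⇒≡ {inj₂ (inj₁ _)}   {inj₂ (inj₁ _)}   x∥y = cong (inj₂ ∘ inj₁) (1*x≡y*1⇒y≡x (x∥y (# 1) (# 2)))
  ∥⇒≡ {inj₂ (inj₁ a)}   {inj₂ (inj₂ tt)}  x∥y = ⊥-elim (1*1≢x*0 a (x∥y (# 1) (# 2)))
  ∥⇒≡ {inj₂ (inj₂ tt)}  {inj₁ (_ , b)}    x∥y = ⊥-elim (1*1≢0*x b (x∥y (# 2) (# 0)))
  ∥⇒≡ {inj₂ (inj₂ tt)}  {inj₂ (inj₁ a)}   x∥y = ⊥-elim (1*1≢0*x a (x∥y (# 2) (# 1)))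
  ∥⇒≡ {inj₂ (inj₂ tt)}  {inj₂ (inj₂ tt)}  _   = refl

  _⊛_ : Fin q → Vec3 → Vec3
  s ⊛ (v₀ , v₁ , v₂) = v₀ * s , v₁ * s , v₂ * s

  ·-⊛ : ∀ s u v → u · (s ⊛ v) ≡ s * (u · v)
  ·-⊛ s (u₀ , u₁ , u₂) (v₀ , v₁ , v₂) = solve 7 (λ s u₀ u₁ u₂ v₀ v₁ v₂ →
    u₀ :* (v₀ :* s) :+ u₁ :* (v₁ :* s) :+ u₂ :* (v₂ :* s) := s :* (u₀ :* v₀ :+ u₁ :* v₁ :+ u₂ :* v₂))
    refl s u₀ u₁ u₂ v₀ v₁ v₂

  normalize : ∀ v → v ≢ 𝟎 → ∃ λ n → ∃ λ s → coordinates n ≡ s ⊛ v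
  normalize (v₀ , v₁ , v₂) v≢𝟎 with v₀ ≟ᶠ 0#
  ... | no v₀≢0 =
    let (s , v₀s≡1) = inverse v₀ v₀≢0
    in  inj₁ (v₁ * s , v₂ * s) , s , cong (_, v₁ * s , v₂ * s) (sym v₀s≡1)
  ... | yes v₀≡0 with v₁ ≟ᶠ 0#
  ...   | no v₁≢0 =
    let (s , v₁s≡1) = inverse v₁ v₁≢0
    in  inj₂ (inj₁ (v₂ * s)) , s ,
        cong₂ (λ x y → x , y , v₂ * s) (sym (x≡0⇒x*y≡0 s v₀≡0)) (sym v₁s≡1)
  ...   | yes v₁≡0 with v₂ ≟ᶠ 0#
  ...     | no v₂≢0 =
    let (s , v₂s≡1) = inverse v₂ v₂≢0
    in  inj₂ (inj₂ tt) , s ,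
        cong₂ _,_ (sym (x≡0⇒x*y≡0 s v₀≡0)) (cong₂ _,_ (sym (x≡0⇒x*y≡0 s v₁≡0)) (sym v₂s≡1))
  ...     | yes v₂≡0 = ⊥-elim (v≢𝟎 (cong₂ _,_ v₀≡0 (cong₂ _,_ v₁≡0 v₂≡0)))

  nonzero-component : ∀ v → v ≢ 𝟎 → ∃ λ k → v ! k ≢ 0#
  nonzero-component (v₀ , v₁ , v₂) v≢𝟎 with v₀ ≟ᶠ 0# | v₁ ≟ᶠ 0# | v₂ ≟ᶠ 0#
  ... | no v₀≢0 | _        | _        = # 0 , v₀≢0
  ... | yes _   | no v₁≢0  | _        = # 1 , v₁≢0
  ... | yes _   | yes _    | no v₂≢0  = # 2 , v₂≢0
  ... | yes v₀≡0 | yes v₁≡0 | yes v₂≡0 = ⊥-elim (v≢𝟎 (cong₂ _,_ v₀≡0 (cong₂ _,_ v₁≡0 v₂≡0)))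

  coordinates-✕≢𝟎 : ∀ {x y} → x ≢ y → coordinates x ✕ coordinates y ≢ 𝟎
  coordinates-✕≢𝟎 {x} {y} x≢y = x≢y ∘ ∥⇒≡ {x} {y} ∘ ✕≡𝟎⇒∥ (coordinates x) (coordinates y)

  join : ∀ {x y} → x ≢ y → ∃ λ L → x I L × y I L
  join {x} {y} x≢y =
    let (L , s , L≡s⊛c) = normalize (cx ✕ cy) (coordinates-✕≢𝟎 x≢y)
        on-L : ∀ {w} → coordinates w · (cx ✕ cy) ≡ 0# → w I L
        on-L {w} w⊥c = ·≡0⇒I {w} {L} (begin
          coordinates w · coordinates L    ≡⟨ cong (coordinates w ·_) L≡s⊛c ⟩
          coordinates w · (s ⊛ (cx ✕ cy))  ≡⟨ ·-⊛ s (coordinates w) (cx ✕ cy) ⟩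
          s * (coordinates w · (cx ✕ cy))  ≡⟨ cong (s *_) w⊥c ⟩
          s * 0#                           ≡⟨ zeroʳ s ⟩
          0#                               ∎)
    in  L , on-L {x} (·-✕ˡ cx cy) , on-L {y} (·-✕ʳ cx cy)
    where
    cx cy : Vec3
    cx = coordinates x
    cy = coordinates y

  join-unique : ∀ {x y L M} → x ≢ y → x I L → y I L → x I M → y I M → L ≡ M
  join-unique {x} {y} {L} {M} x≢y xL yL xM yM with L ≟ₚ M
  ... | yes L≡M = L≡M
  ... | no  L≢M =
    let (k , cₖ≢0) = nonzero-component _ (coordinates-✕≢𝟎 L≢M)
    in  ⊥-elim (x≢y (∥⇒≡ {x} {y} (∥-trans k cₖ≢0
          (⊥⇒∥✕ (I⇒·≡0 {x} {L} xL) (I⇒·≡0 {x} {M} xM))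
          (⊥⇒∥✕ (I⇒·≡0 {y} {L} yL) (I⇒·≡0 {y} {M} yM)))))

  meet : ∀ {ℓ m} → ℓ ≢ m → Intersect (PG F) ℓ m
  meet {ℓ} {m} ℓ≢m = let (w , ℓw , mw) = join ℓ≢m in w , I-sym {ℓ} {w} ℓw , I-sym {m} {w} mw

  ·-e₀ : ∀ a b c → (1# , 0# , 0#) · (a , b , c) ≡ a
  ·-e₀ = solve 3 (λ a b c → :1 :* a :+ :0 :* b :+ :0 :* c := a) refl

  ·-e₁ : ∀ a b c → (0# , 1# , 0#) · (a , b , c) ≡ b
  ·-e₁ = solve 3 (λ a b c → :0 :* a :+ :1 :* b :+ :0 :* c := b) refl

  ·-e₂ : ∀ a b c → (0# , 0# , 1#) · (a , b , c) ≡ c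
  ·-e₂ = solve 3 (λ a b c → :0 :* a :+ :0 :* b :+ :1 :* c := c) refl

  -- corner L is a coordinate point off L; the q + 1 lines of pencil L through it meet L in
  -- q + 1 distinct points.
  corner : Proj q → Proj q
  corner (inj₁ _)         = inj₁ (0# , 0#)
  corner (inj₂ (inj₁ _))  = inj₂ (inj₁ 0#)
  corner (inj₂ (inj₂ tt)) = inj₂ (inj₂ tt)

  corner-∉ : ∀ L → ¬ corner L I L
  corner-∉ (inj₁ (a , b))   h = 0≢1 (trans (sym h) (·-e₀ 1# a b))
  corner-∉ (inj₂ (inj₁ a))  h = 0≢1 (trans (sym h) (·-e₁ 0# 1# a))
  corner-∉ (inj₂ (inj₂ tt)) h = 0≢1 (trans (sym h) (·-e₂ 0# 0# 1#))

  pencil : Proj q → Fin (suc q) → Proj q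
  pencil (inj₁ _)         zero    = inj₂ (inj₂ tt)
  pencil (inj₁ _)         (suc t) = inj₂ (inj₁ t)
  pencil (inj₂ (inj₁ _))  zero    = inj₂ (inj₂ tt)
  pencil (inj₂ (inj₁ _))  (suc t) = inj₁ (0# , t)
  pencil (inj₂ (inj₂ tt)) zero    = inj₂ (inj₁ 0#)
  pencil (inj₂ (inj₂ tt)) (suc t) = inj₁ (t , 0#)

  corner-∈-pencil : ∀ L k → corner L I pencil L k
  corner-∈-pencil (inj₁ _)         zero    = ·-e₀ 0# 0# 1#
  corner-∈-pencil (inj₁ _)         (suc t) = ·-e₀ 0# 1# t
  corner-∈-pencil (inj₂ (inj₁ _))  zero    = ·-e₁ 0# 0# 1#
  corner-∈-pencil (inj₂ (inj₁ _))  (suc t) = ·-e₁ 1# 0# t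
  corner-∈-pencil (inj₂ (inj₂ tt)) zero    = ·-e₂ 0# 1# 0#
  corner-∈-pencil (inj₂ (inj₂ tt)) (suc t) = ·-e₂ 1# t 0#

  pencil-injective : ∀ L → Injective _≡_ _≡_ (pencil L)
  pencil-injective (inj₁ _)         {suc _} {suc _} refl = refl
  pencil-injective (inj₂ (inj₁ _))  {suc _} {suc _} refl = refl
  pencil-injective (inj₂ (inj₂ tt)) {suc _} {suc _} refl = refl
  pencil-injective _                {zero}  {zero}  _    = refl

  pencil-≢ : ∀ L k → pencil L k ≢ L
  pencil-≢ L k pencil≡L = corner-∉ L (subst (corner L I_) pencil≡L (corner-∈-pencil L k))

  point-on : Proj q → Fin (suc q) → Proj q
  point-on L k = proj₁ (meet (pencil-≢ L k))

  point-on-pencil : ∀ L k → point-on L k I pencil L k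
  point-on-pencil L k = proj₁ (proj₂ (meet (pencil-≢ L k)))

  point-on-I : ∀ L k → point-on L k I L
  point-on-I L k = proj₂ (proj₂ (meet (pencil-≢ L k)))

  point-on-injective : ∀ L → Injective _≡_ _≡_ (point-on L)
  point-on-injective L {i} {j} same = pencil-injective L (join-unique {point-on L i} {corner L}
    (λ P≡corner → corner-∉ L (subst (_I L) P≡corner (point-on-I L i)))
    (point-on-pencil L i) (corner-∈-pencil L i)
    (subst (_I pencil L j) (sym same) (point-on-pencil L j)) (corner-∈-pencil L j))

  point-avoiding : ∀ L x y → ∃ λ u → u I L × u ≢ x × u ≢ y
  point-avoiding L x y =
    let (k , k∉) = avoid _≟ₚ_ (point-on L) (point-on-injective L) (x ∷ y ∷ []) (s≤s 2≤q)
    in  point-on L k , point-on-I L k , k∉ ∘ here , k∉ ∘ there ∘ here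

  lines-meet : ∀ ℓ m → Intersect (PG F) ℓ m
  lines-meet ℓ m with ℓ ≟ₚ m
  ... | yes refl = let (w , wℓ , _) = point-avoiding ℓ ℓ ℓ in w , wℓ , wℓ
  ... | no  ℓ≢m  = meet ℓ≢m

  isThickPlane : IsThickPlane (PG F)
  isThickPlane = record
    { _≟ₚ_           = _≟ₚ_
    ; join           = join
    ; join-unique    = join-unique
    ; point-avoiding = point-avoiding
    ; line-avoiding  = line-avoiding
    ; transversal    = transversal
    }
    where
    line-avoiding : ∀ p L M → ∃ λ N → p I N × N ≢ L × N ≢ M
    line-avoiding p L M =
      let (N , N∈p , N≢L , N≢M) = point-avoiding p L M in N , I-sym {N} {p} N∈p , N≢L , N≢M

    transversal : ∀ b L ℓ ℓ′ → ∃ λ m → b I m × m ≢ L × Intersect (PG F) m ℓ × Intersect (PG F) m ℓ′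
    transversal b L ℓ ℓ′ =
      let (m , bm , m≢L , _) = line-avoiding b L L in m , bm , m≢L , lines-meet m ℓ , lines-meet m ℓ′

proposition5p3 : ((q : ℕ) → 3 ≤ q → (F : FiniteField q) →
    ResiduallyConnected (TriangleComplex (AG F)))
    × ((q : ℕ) → 2 ≤ q → (F : FiniteField q) →
    ResiduallyConnected (TriangleComplex (PG F)))
proposition5p3 =
  (λ q 3≤q F → Connectivity.residually-connected (AffinePlane.isThickPlane F 3≤q)) ,
  (λ q 2≤q F → Connectivity.residually-connected (ProjectivePlane.isThickPlane F 2≤q))
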